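{- For each integer $d\geq2$ and each $m\in\mathbb{N}$ we have $W_{d,m}(x)\equiv(1+x^{d-1})^m\pmod{d-1}$ (coefficientwise). In particular, if $p$ is a prime number then $W_{p+1,m}(x)\equiv(1+x)^{pm}\pmod p$ for all $m\in\mathbb{N}$.
   Context: $\mathbb{N}$ denotes the non-negative integers. For an integer $d\ge2$ the polynomials $W_{d,m}(x)\in\mathbb{Z}[x]$ are defined by $W_{d,0}(x)=1$ and $W_{d,m+1}(x)=W_{d,m}'(x)+(1+x^{d-1})W_{d,m}(x)$; equivalently, $\frac{d^m}{dx^m}e^{x+x^d/d}=W_{d,m}(x)e^{x+x^d/d}$. -}

module Defs where

open import Data.Nat as ℕ using (ℕ; zero; suc; _∸_; _≡ᵇ_)
open import Data.Bool using (if_then_else_)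
open import Data.Integer as ℤ using (ℤ; +_; _+_; _*_; _-_)
open import Data.Integer.Divisibility using (_∣_)

-- A polynomial in ℤ[x] is represented by its coefficient sequence:
-- coeff k = coefficient of x^k.  All polynomials built below have finite support.
Poly : Set
Poly = ℕ → ℤ

one : Poly
one zero    = + 1
one (suc _) = + 0

X^ : ℕ → Poly
X^ n k = if n ≡ᵇ k then + 1 else + 0

_⊕_ : Poly → Poly → Poly
(P ⊕ Q) k = P k + Q k

convSum : (ℕ → ℕ → ℤ) → ℕ → ℤ
convSum f k = go k
  where
  go : ℕ → ℤ
  go zero    = f zero k
  go (suc i) = go i + f (suc i) (k ∸ suc i)

_⊗_ : Poly → Poly → Poly
(P ⊗ Q) k = convSum (λ i j → P i * Q j) k

_^ᵖ_ : Poly → ℕ → Poly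
P ^ᵖ zero  = one
P ^ᵖ suc m = P ⊗ (P ^ᵖ m)

deriv : Poly → Poly
deriv P k = + (suc k) * P (suc k)

W : ℕ → ℕ → Poly
W d zero    = one
W d (suc m) = deriv (W d m) ⊕ ((one ⊕ X^ (d ∸ 1)) ⊗ W d m)

_≡_[modᵖ_] : Poly → Poly → ℕ → Set
P ≡ Q [modᵖ n ] = ∀ k → (+ n) ∣ (P k - Q k)

{-# OPTIONS --safe #-}
-- With A = 1 + x^(d-1) and n = d - 1, every power of A has derivative ≡ 0 (mod n):
-- this holds for 1 and for x^(d-1), whose derivative is n·x^(d-2), and the
-- product rule preserves it. The recursion W_{m+1} = W_m′ + A·W_m then gives
-- W_m ≡ A^m by induction. For d = p + 1 it remains to show
-- (1 + x^p)^m ≡ (1 + x)^(pm) (mod p). Multiplying (1 + x)^(mp) by 1 + x one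
-- factor at a time gives (1 + x)^(p + mp) = Σ C(p,i)·x^i·(1 + x)^(mp) without
-- using associativity of the product, and p divides C(p,i) for 0 < i < p by
-- Euclid's lemma applied to i·C(p,i) = p·C(p-1,i-1).
module Submission where

open import Defs
open import Data.Nat as ℕ using (ℕ; zero; suc; _∸_)
import Data.Nat.Properties as ℕₚ
open import Function using (_∘_)
open import Relation.Binary.PropositionalEquality

module IntegerCongruence where
  open import Data.Integer using (ℤ; +_; 0ℤ; _+_; _*_; _-_; -_)
  open import Data.Integer.Properties using (+-inverseʳ; +-minus-telescope)
  open import Data.Integer.Divisibility.Signed using (_∣_; divides; ∣m⇒∣-m; ∣m∣n⇒∣m+n; ∣n⇒∣m*n; ∣m⇒∣m*n; ∣ᵤ⇒∣)
  open import Data.Integer.Tactic.RingSolver using (solve-∀)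
  open import Data.Nat.Divisibility using () renaming (_∣_ to _∣ℕ_)
  open import Relation.Binary.Bundles using (Setoid)

  infix 4 _≡_[modℤ_] _≋_[mod_]

  -- A record rather than a function, so that both sides can be inferred from it.
  record _≡_[modℤ_] (a b : ℤ) (n : ℕ) : Set where
    constructor mod-divides
    field
      divides-difference : + n ∣ (a - b)

  open _≡_[modℤ_] public

  private
    mod-by : ∀ {n a b x} → x ≡ a - b → + n ∣ x → a ≡ b [modℤ n ]
    mod-by refl = mod-divides

  module _ {n : ℕ} where

    ≡⇒≡[modℤ] : ∀ {a b} → a ≡ b → a ≡ b [modℤ n ]
    ≡⇒≡[modℤ] {a} refl = mod-divides (divides 0ℤ (+-inverseʳ a))

    modℤ-sym : ∀ {a b} → a ≡ b [modℤ n ] → b ≡ a [modℤ n ]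
    modℤ-sym {a} {b} (mod-divides n∣a-b) = mod-by (negate a b) (∣m⇒∣-m n∣a-b)
      where
      negate : ∀ a b → - (a - b) ≡ b - a
      negate = solve-∀

    modℤ-trans : ∀ {a b c} → a ≡ b [modℤ n ] → b ≡ c [modℤ n ] → a ≡ c [modℤ n ]
    modℤ-trans {a} {b} {c} (mod-divides n∣a-b) (mod-divides n∣b-c) =
      mod-by (+-minus-telescope a b c) (∣m∣n⇒∣m+n n∣a-b n∣b-c)

    +-cong-modℤ : ∀ {a b c d} → a ≡ b [modℤ n ] → c ≡ d [modℤ n ] → a + c ≡ b + d [modℤ n ]
    +-cong-modℤ {a} {b} {c} {d} (mod-divides n∣a-b) (mod-divides n∣c-d) =
      mod-by (regroup a b c d) (∣m∣n⇒∣m+n n∣a-b n∣c-d)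
      where
      regroup : ∀ a b c d → (a - b) + (c - d) ≡ (a + c) - (b + d)
      regroup = solve-∀

    *-congˡ-modℤ : ∀ c {a b} → a ≡ b [modℤ n ] → c * a ≡ c * b [modℤ n ]
    *-congˡ-modℤ c {a} {b} (mod-divides n∣a-b) = mod-by (distrib c a b) (∣n⇒∣m*n c n∣a-b)
      where
      distrib : ∀ c a b → c * (a - b) ≡ c * a - c * b
      distrib = solve-∀

    *-congʳ-modℤ : ∀ c {a b} → a ≡ b [modℤ n ] → a * c ≡ b * c [modℤ n ]
    *-congʳ-modℤ c {a} {b} (mod-divides n∣a-b) = mod-by (distrib c a b) (∣m⇒∣m*n c n∣a-b)
      where
      distrib : ∀ c a b → (a - b) * c ≡ a * c - b * c
      distrib = solve-∀

    ∣⇒*≡0[modℤ] : ∀ {m} x → n ∣ℕ m → + m * x ≡ 0ℤ [modℤ n ]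
    ∣⇒*≡0[modℤ] {m} x n∣m = mod-by (minus-zero (+ m * x)) (∣m⇒∣m*n x (∣ᵤ⇒∣ {i = + m} n∣m))
      where
      minus-zero : ∀ a → a ≡ a - 0ℤ
      minus-zero = solve-∀

  _≋_[mod_] : Poly → Poly → ℕ → Set
  P ≋ Q [mod n ] = ∀ k → P k ≡ Q k [modℤ n ]

  modℤ-setoid : ℕ → Setoid _ _
  modℤ-setoid n = record
    { Carrier       = ℤ
    ; _≈_           = _≡_[modℤ n ]
    ; isEquivalence = record { refl = ≡⇒≡[modℤ] refl ; sym = modℤ-sym ; trans = modℤ-trans }
    }

module Convolution where
  open import Data.Integer using (ℤ; +_; 0ℤ; _+_; _*_)
  open import Data.Integer.Properties using (+-assoc; +-0-monoid; +-identityʳ; *-identityˡ; *-zeroʳ; *-distribʳ-+)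
  open import Data.Integer.Tactic.RingSolver using (solve-∀)
  open import Tactic.MonoidSolver using (solve)
  open IntegerCongruence

  sumTo : (ℕ → ℤ) → ℕ → ℤ
  sumTo g zero    = g zero
  sumTo g (suc i) = sumTo g i + g (suc i)

  sumTo-peel : ∀ g i → sumTo g (suc i) ≡ g 0 + sumTo (g ∘ suc) i
  sumTo-peel g zero    = refl
  sumTo-peel g (suc i) = trans (cong (_+ g (suc (suc i))) (sumTo-peel g i))
                               (+-assoc (g 0) (sumTo (g ∘ suc) i) (g (suc (suc i))))

  sumTo-cong : ∀ {g h} → g ≗ h → ∀ i → sumTo g i ≡ sumTo h i
  sumTo-cong g≗h zero    = g≗h zero
  sumTo-cong g≗h (suc i) = cong₂ _+_ (sumTo-cong g≗h i) (g≗h (suc i))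

  sumTo-+ : ∀ g h i → sumTo (λ t → g t + h t) i ≡ sumTo g i + sumTo h i
  sumTo-+ g h zero    = refl
  sumTo-+ g h (suc i) = trans (cong (_+ (g (suc i) + h (suc i))) (sumTo-+ g h i))
                              (interchange (sumTo g i) (sumTo h i) (g (suc i)) (h (suc i)))
    where
    interchange : ∀ a b c d → (a + b) + (c + d) ≡ (a + c) + (b + d)
    interchange = solve-∀

  sumTo-zero : ∀ {g} → (∀ t → g t ≡ 0ℤ) → ∀ i → sumTo g i ≡ 0ℤ
  sumTo-zero g≡0 zero    = g≡0 zero
  sumTo-zero g≡0 (suc i) = cong₂ _+_ (sumTo-zero g≡0 i) (g≡0 (suc i))

  sumTo-cong-modℤ : ∀ {n g h} i → (∀ t → t ℕ.≤ i → g t ≡ h t [modℤ n ]) → sumTo g i ≡ sumTo h i [modℤ n ]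
  sumTo-cong-modℤ zero    g≡h = g≡h zero ℕ.z≤n
  sumTo-cong-modℤ (suc i) g≡h =
    +-cong-modℤ (sumTo-cong-modℤ i (λ t t≤i → g≡h t (ℕₚ.m≤n⇒m≤1+n t≤i))) (g≡h (suc i) ℕₚ.≤-refl)

  -- convSum runs a local loop that cannot be named from here, so the statement
  -- about it, sumTo (λ t → f t (K ∸ t)) i + z ≡ loop i + z, is left for
  -- unification to infer from sumTo≡convSum-suc, where abstracting over suc m
  -- makes the arguments of the loop distinct variables. The monoid solver then
  -- treats the loop as an atom.
  private
    mutual
      LoopSpec : (ℕ → ℕ → ℤ) → ℕ → ℕ → ℤ → Set
      LoopSpec = _

      sumTo≡convSum-suc : ∀ f m → sumTo (λ t → f t (suc m ∸ t)) (suc m) ≡ convSum f (suc m)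
      sumTo≡convSum-suc f m with suc m | f (suc m) (m ∸ m)
      ... | K | z = sumTo≡loop f K m z

      sumTo≡loop : ∀ f K i z → LoopSpec f K i z
      sumTo≡loop f K zero    z = refl
      sumTo≡loop f K (suc i) z = let y = f (suc i) (K ∸ suc i) in
        trans (+-assoc (sumTo (λ t → f t (K ∸ t)) i) y z) (trans (sumTo≡loop f K i (y + z)) (solve +-0-monoid))

  convSum≡sumTo : ∀ f k → convSum f k ≡ sumTo (λ t → f t (k ∸ t)) k
  convSum≡sumTo f zero    = refl
  convSum≡sumTo f (suc m) = sym (sumTo≡convSum-suc f m)

  ⊗-coeff : ∀ P Q k → (P ⊗ Q) k ≡ sumTo (λ t → P t * Q (k ∸ t)) k
  ⊗-coeff P Q = convSum≡sumTo (λ i j → P i * Q j)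

  ⊗-peel : ∀ P Q k → (P ⊗ Q) (suc k) ≡ P 0 * Q (suc k) + ((P ∘ suc) ⊗ Q) k
  ⊗-peel P Q k = begin
    (P ⊗ Q) (suc k)                                              ≡⟨ ⊗-coeff P Q (suc k) ⟩
    sumTo (λ t → P t * Q (suc k ∸ t)) (suc k)                    ≡⟨ sumTo-peel _ k ⟩
    P 0 * Q (suc k) + sumTo (λ t → P (suc t) * Q (k ∸ t)) k     ≡⟨ cong (λ s → P 0 * Q (suc k) + s) (⊗-coeff (P ∘ suc) Q k) ⟨
    P 0 * Q (suc k) + ((P ∘ suc) ⊗ Q) k                          ∎
    where open ≡-Reasoning

  ⊗-congˡ : ∀ {P P′} → P ≗ P′ → ∀ Q k → (P ⊗ Q) k ≡ (P′ ⊗ Q) k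
  ⊗-congˡ {P} {P′} P≗P′ Q k = begin
    (P ⊗ Q) k                            ≡⟨ ⊗-coeff P Q k ⟩
    sumTo (λ t → P t * Q (k ∸ t)) k      ≡⟨ sumTo-cong (λ t → cong (_* Q (k ∸ t)) (P≗P′ t)) k ⟩
    sumTo (λ t → P′ t * Q (k ∸ t)) k     ≡⟨ ⊗-coeff P′ Q k ⟨
    (P′ ⊗ Q) k                           ∎
    where open ≡-Reasoning

  ⊗-distribʳ-⊕ : ∀ P P′ Q k → ((P ⊕ P′) ⊗ Q) k ≡ (P ⊗ Q) k + (P′ ⊗ Q) k
  ⊗-distribʳ-⊕ P P′ Q k = begin
    ((P ⊕ P′) ⊗ Q) k                                                      ≡⟨ ⊗-coeff (P ⊕ P′) Q k ⟩
    sumTo (λ t → (P t + P′ t) * Q (k ∸ t)) k                              ≡⟨ sumTo-cong (λ t → *-distribʳ-+ (Q (k ∸ t)) (P t) (P′ t)) k ⟩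
    sumTo (λ t → P t * Q (k ∸ t) + P′ t * Q (k ∸ t)) k                    ≡⟨ sumTo-+ _ _ k ⟩
    sumTo (λ t → P t * Q (k ∸ t)) k + sumTo (λ t → P′ t * Q (k ∸ t)) k    ≡⟨ cong₂ _+_ (⊗-coeff P Q k) (⊗-coeff P′ Q k) ⟨
    (P ⊗ Q) k + (P′ ⊗ Q) k                                                ∎
    where open ≡-Reasoning

  ⊗-zeroˡ : ∀ {P} → (∀ i → P i ≡ 0ℤ) → ∀ Q k → (P ⊗ Q) k ≡ 0ℤ
  ⊗-zeroˡ {P} P≡0 Q k = trans (⊗-coeff P Q k) (sumTo-zero (λ t → cong (_* Q (k ∸ t)) (P≡0 t)) k)

  ⊗-zeroʳ : ∀ {Q} P → (∀ i → Q i ≡ 0ℤ) → ∀ k → (P ⊗ Q) k ≡ 0ℤ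
  ⊗-zeroʳ {Q} P Q≡0 k = trans (⊗-coeff P Q k) (sumTo-zero (λ t → trans (cong (P t *_) (Q≡0 (k ∸ t))) (*-zeroʳ (P t))) k)

  ⊗-identityˡ : ∀ P → P 0 ≡ + 1 → (∀ i → P (suc i) ≡ 0ℤ) → ∀ Q k → (P ⊗ Q) k ≡ Q k
  ⊗-identityˡ P P0≡1 P₊≡0 Q zero    = trans (cong (_* Q 0) P0≡1) (*-identityˡ (Q 0))
  ⊗-identityˡ P P0≡1 P₊≡0 Q (suc k) = begin
    (P ⊗ Q) (suc k)                          ≡⟨ ⊗-peel P Q k ⟩
    P 0 * Q (suc k) + ((P ∘ suc) ⊗ Q) k      ≡⟨ cong₂ _+_ (cong (_* Q (suc k)) P0≡1) (⊗-zeroˡ P₊≡0 Q k) ⟩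
    + 1 * Q (suc k) + 0ℤ                     ≡⟨ +-identityʳ _ ⟩
    + 1 * Q (suc k)                          ≡⟨ *-identityˡ _ ⟩
    Q (suc k)                                ∎
    where open ≡-Reasoning

  module _ {n : ℕ} where

    ⊗-congˡ-modℤ : ∀ {P P′} → P ≋ P′ [mod n ] → ∀ Q → P ⊗ Q ≋ P′ ⊗ Q [mod n ]
    ⊗-congˡ-modℤ {P} {P′} P≡P′ Q k = subst₂ _≡_[modℤ n ] (sym (⊗-coeff P Q k)) (sym (⊗-coeff P′ Q k))
      (sumTo-cong-modℤ k (λ t _ → *-congʳ-modℤ (Q (k ∸ t)) (P≡P′ t)))

    ⊗-congʳ-modℤ : ∀ {Q Q′} P → Q ≋ Q′ [mod n ] → P ⊗ Q ≋ P ⊗ Q′ [mod n ]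
    ⊗-congʳ-modℤ {Q} {Q′} P Q≡Q′ k = subst₂ _≡_[modℤ n ] (sym (⊗-coeff P Q k)) (sym (⊗-coeff P Q′ k))
      (sumTo-cong-modℤ k (λ t _ → *-congˡ-modℤ (P t) (Q≡Q′ (k ∸ t))))

module VanishingDerivative where
  open import Data.Integer using (+_; 0ℤ; _+_; _*_)
  open import Data.Integer.Properties using (+-identityˡ; *-zeroʳ; *-distribˡ-+)
  open import Data.Integer.Tactic.RingSolver using (solve-∀)
  open import Data.Bool using (true; false; T)
  open import Data.Unit using (tt)
  open import Data.Nat.Divisibility using (∣-refl)
  import Relation.Binary.Reasoning.Setoid as SetoidReasoning
  open IntegerCongruence
  open Convolution

  euler : Poly → Poly
  euler P k = + k * P k

  euler-∘suc : ∀ P → euler P ∘ suc ≗ euler (P ∘ suc) ⊕ (P ∘ suc)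
  euler-∘suc P t = expand (+ t) (P (suc t))
    where
    expand : ∀ κ x → (+ 1 + κ) * x ≡ κ * x + x
    expand = solve-∀

  euler-⊗ : ∀ P Q k → euler (P ⊗ Q) k ≡ (euler P ⊗ Q) k + (P ⊗ euler Q) k
  euler-⊗ P Q zero    = sym (trans (+-identityˡ _) (*-zeroʳ (P 0)))
  euler-⊗ P Q (suc k) = begin
    + suc k * (P ⊗ Q) (suc k)                       ≡⟨ cong (+ suc k *_) (⊗-peel P Q k) ⟩
    + suc k * (P 0 * Q (suc k) + S)                 ≡⟨ expand (+ k) (P 0) (Q (suc k)) S ⟩
    (+ k * S + S) + P 0 * euler Q (suc k)           ≡⟨ cong (λ e → (e + S) + P 0 * euler Q (suc k)) (euler-⊗ P₊ Q k) ⟩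
    ((E + F) + S) + P 0 * euler Q (suc k)           ≡⟨ regroup E F S (P 0 * euler Q (suc k)) ⟩
    (E + S) + (P 0 * euler Q (suc k) + F)           ≡⟨ cong₂ _+_ euler-peel (⊗-peel P (euler Q) k) ⟨
    (euler P ⊗ Q) (suc k) + (P ⊗ euler Q) (suc k)   ∎
    where
    open ≡-Reasoning
    P₊ = P ∘ suc
    S = (P₊ ⊗ Q) k
    E = (euler P₊ ⊗ Q) k
    F = (P₊ ⊗ euler Q) k

    expand : ∀ κ p q s → (+ 1 + κ) * (p * q + s) ≡ (κ * s + s) + p * ((+ 1 + κ) * q)
    expand = solve-∀

    regroup : ∀ e f s r → ((e + f) + s) + r ≡ (e + s) + (r + f)
    regroup = solve-∀

    euler-peel : (euler P ⊗ Q) (suc k) ≡ E + S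
    euler-peel = begin
      (euler P ⊗ Q) (suc k)                   ≡⟨ ⊗-peel (euler P) Q k ⟩
      0ℤ + ((euler P ∘ suc) ⊗ Q) k            ≡⟨ +-identityˡ _ ⟩
      ((euler P ∘ suc) ⊗ Q) k                 ≡⟨ ⊗-congˡ (euler-∘suc P) Q k ⟩
      ((euler P₊ ⊕ P₊) ⊗ Q) k                 ≡⟨ ⊗-distribʳ-⊕ (euler P₊) P₊ Q k ⟩
      E + S                                   ∎

  -- k · P k is the coefficient of x^(k-1) in P′, so this says P′ ≡ 0 (mod n).
  _′≡0[mod_] : Poly → ℕ → Set
  P ′≡0[mod n ] = euler P ≋ (λ _ → 0ℤ) [mod n ]

  module _ {n : ℕ} where

    ′≡0-⊗ : ∀ {P Q} → P ′≡0[mod n ] → Q ′≡0[mod n ] → (P ⊗ Q) ′≡0[mod n ]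
    ′≡0-⊗ {P} {Q} P′≡0 Q′≡0 k = begin
      euler (P ⊗ Q) k                               ≡⟨ euler-⊗ P Q k ⟩
      (euler P ⊗ Q) k + (P ⊗ euler Q) k             ≈⟨ +-cong-modℤ (⊗-congˡ-modℤ P′≡0 Q k) (⊗-congʳ-modℤ P Q′≡0 k) ⟩
      ((λ _ → 0ℤ) ⊗ Q) k + (P ⊗ (λ _ → 0ℤ)) k      ≡⟨ cong₂ _+_ (⊗-zeroˡ (λ _ → refl) Q k) (⊗-zeroʳ P (λ _ → refl) k) ⟩
      0ℤ                                            ∎
      where open SetoidReasoning (modℤ-setoid n)

    ′≡0-⊕ : ∀ {P Q} → P ′≡0[mod n ] → Q ′≡0[mod n ] → (P ⊕ Q) ′≡0[mod n ]
    ′≡0-⊕ {P} {Q} P′≡0 Q′≡0 k = begin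
      + k * (P k + Q k)            ≡⟨ *-distribˡ-+ (+ k) (P k) (Q k) ⟩
      + k * P k + + k * Q k        ≈⟨ +-cong-modℤ (P′≡0 k) (Q′≡0 k) ⟩
      0ℤ                           ∎
      where open SetoidReasoning (modℤ-setoid n)

    one′≡0 : one ′≡0[mod n ]
    one′≡0 zero    = ≡⇒≡[modℤ] refl
    one′≡0 (suc k) = ≡⇒≡[modℤ] (*-zeroʳ (+ suc k))

    ^ᵖ′≡0 : ∀ {P} → P ′≡0[mod n ] → ∀ m → (P ^ᵖ m) ′≡0[mod n ]
    ^ᵖ′≡0 P′≡0 zero    = one′≡0
    ^ᵖ′≡0 P′≡0 (suc m) = ′≡0-⊗ P′≡0 (^ᵖ′≡0 P′≡0 m)

  X^′≡0 : ∀ n → X^ n ′≡0[mod n ]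
  X^′≡0 n k with n ℕ.≡ᵇ k in n≡ᵇk
  ... | false = ≡⇒≡[modℤ] (*-zeroʳ (+ k))
  ... | true rewrite ℕₚ.≡ᵇ⇒≡ n k (subst T (sym n≡ᵇk) tt) = ∣⇒*≡0[modℤ] (+ 1) ∣-refl

  W≡[1+x^[d∸1]]^m : ∀ d m → W d m ≋ (one ⊕ X^ (d ∸ 1)) ^ᵖ m [mod d ∸ 1 ]
  W≡[1+x^[d∸1]]^m d zero    k = ≡⇒≡[modℤ] refl
  W≡[1+x^[d∸1]]^m d (suc m) k = begin
    deriv (W d m) k + (A ⊗ W d m) k          ≈⟨ +-cong-modℤ (*-congˡ-modℤ (+ suc k) (IH (suc k))) (⊗-congʳ-modℤ A IH k) ⟩
    deriv (A ^ᵖ m) k + (A ⊗ (A ^ᵖ m)) k      ≈⟨ +-cong-modℤ (^ᵖ′≡0 (′≡0-⊕ one′≡0 (X^′≡0 (d ∸ 1))) m (suc k)) (≡⇒≡[modℤ] refl) ⟩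
    0ℤ + (A ^ᵖ suc m) k                      ≡⟨ +-identityˡ _ ⟩
    (A ^ᵖ suc m) k                           ∎
    where
    open SetoidReasoning (modℤ-setoid (d ∸ 1))
    A = one ⊕ X^ (d ∸ 1)
    IH = W≡[1+x^[d∸1]]^m d m

module Frobenius where
  open import Data.Integer using (ℤ; +_; 0ℤ; _+_; _*_)
  open import Data.Integer.Properties using (+-identityˡ; +-identityʳ; *-identityˡ; *-zeroʳ; *-distribʳ-+)
  open import Data.Integer.Tactic.RingSolver using (solve-∀)
  import Data.Nat.Tactic.RingSolver as ℕ-Solver
  open import Data.Nat.Combinatorics using (_C_; nCn≡1; nC1≡n; k>n⇒nCk≡0; nCk+nC[k+1]≡[n+1]C[k+1])
  open import Data.Nat.Divisibility using (_∣_; divides; ∣⇒≤)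
  open import Data.Nat.Primality using (Prime; euclidsLemma; ¬prime[0]; ¬prime[1])
  open import Data.Sum using (inj₁; inj₂)
  open import Data.Empty using (⊥-elim)
  import Relation.Binary.Reasoning.Setoid as SetoidReasoning
  open IntegerCongruence
  open Convolution

  shift : ℕ → Poly → Poly
  shift zero    Q k       = Q k
  shift (suc a) Q zero    = 0ℤ
  shift (suc a) Q (suc k) = shift a Q k

  X^-⊗ : ∀ a Q k → (X^ a ⊗ Q) k ≡ shift a Q k
  X^-⊗ zero    Q k       = ⊗-identityˡ (X^ 0) refl (λ _ → refl) Q k
  X^-⊗ (suc a) Q zero    = refl
  X^-⊗ (suc a) Q (suc k) = trans (⊗-peel (X^ (suc a)) Q k) (trans (+-identityˡ _) (X^-⊗ a Q k))

  one⊕X^-⊗ : ∀ a Q k → ((one ⊕ X^ a) ⊗ Q) k ≡ Q k + shift a Q k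
  one⊕X^-⊗ a Q k = trans (⊗-distribʳ-⊕ one (X^ a) Q k) (cong₂ _+_ (⊗-identityˡ one refl (λ _ → refl) Q k) (X^-⊗ a Q k))

  shift-cong-modℤ : ∀ {n Q Q′} a → Q ≋ Q′ [mod n ] → shift a Q ≋ shift a Q′ [mod n ]
  shift-cong-modℤ zero    Q≡Q′ k       = Q≡Q′ k
  shift-cong-modℤ (suc a) Q≡Q′ zero    = ≡⇒≡[modℤ] refl
  shift-cong-modℤ (suc a) Q≡Q′ (suc k) = shift-cong-modℤ a Q≡Q′ k

  [k+1]*[n+1]C[k+1]≡[n+1]*nCk : ∀ n k → suc k ℕ.* (suc n C suc k) ≡ suc n ℕ.* (n C k)
  [k+1]*[n+1]C[k+1]≡[n+1]*nCk zero    zero    = refl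
  [k+1]*[n+1]C[k+1]≡[n+1]*nCk zero    (suc k) = ℕₚ.*-zeroʳ (suc (suc k))
  [k+1]*[n+1]C[k+1]≡[n+1]*nCk (suc n) zero    =
    trans (ℕₚ.*-identityˡ _) (trans (nC1≡n (suc (suc n))) (sym (ℕₚ.*-identityʳ (suc (suc n)))))
  [k+1]*[n+1]C[k+1]≡[n+1]*nCk (suc n) (suc k) = begin
    suc (suc k) ℕ.* (suc (suc n) C suc (suc k))   ≡⟨ cong (suc (suc k) ℕ.*_) (nCk+nC[k+1]≡[n+1]C[k+1] (suc n) (suc k)) ⟨
    suc (suc k) ℕ.* (c ℕ.+ d)                      ≡⟨ split (suc k) c d ⟩
    (suc k ℕ.* c ℕ.+ c) ℕ.+ suc (suc k) ℕ.* d      ≡⟨ cong₂ (λ x y → (x ℕ.+ c) ℕ.+ y) ([k+1]*[n+1]C[k+1]≡[n+1]*nCk n k) ([k+1]*[n+1]C[k+1]≡[n+1]*nCk n (suc k)) ⟩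
    (suc n ℕ.* a ℕ.+ c) ℕ.+ suc n ℕ.* b            ≡⟨ merge (suc n) a b c ⟩
    suc n ℕ.* (a ℕ.+ b) ℕ.+ c                      ≡⟨ cong (λ x → suc n ℕ.* x ℕ.+ c) (nCk+nC[k+1]≡[n+1]C[k+1] n k) ⟩
    suc n ℕ.* c ℕ.+ c                              ≡⟨ ℕₚ.+-comm (suc n ℕ.* c) c ⟩
    suc (suc n) ℕ.* c                              ∎
    where
    open ≡-Reasoning
    a = n C k
    b = n C suc k
    c = suc n C suc k
    d = suc n C suc (suc k)

    split : ∀ κ c d → suc κ ℕ.* (c ℕ.+ d) ≡ (κ ℕ.* c ℕ.+ c) ℕ.+ suc κ ℕ.* d
    split = ℕ-Solver.solve-∀

    merge : ∀ ν a b c → (ν ℕ.* a ℕ.+ c) ℕ.+ ν ℕ.* b ≡ ν ℕ.* (a ℕ.+ b) ℕ.+ c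
    merge = ℕ-Solver.solve-∀

  prime∣C : ∀ {p k} → Prime p → 0 ℕ.< k → k ℕ.< p → p ∣ p C k
  prime∣C {suc n} {suc i} p-prime _ k<p
    with euclidsLemma (suc i) (suc n C suc i) p-prime
           (divides (n C i) (trans ([k+1]*[n+1]C[k+1]≡[n+1]*nCk n i) (ℕₚ.*-comm (suc n) (n C i))))
  ... | inj₁ p∣k = ⊥-elim (ℕₚ.<⇒≱ k<p (∣⇒≤ p∣k))
  ... | inj₂ p∣C = p∣C

  binomialSum : ℕ → (ℕ → ℤ) → ℤ
  binomialSum j s = sumTo (λ i → + (j C i) * s i) j

  binomialSum-suc : ∀ j s → binomialSum (suc j) s ≡ binomialSum j s + binomialSum j (s ∘ suc)
  binomialSum-suc j s = begin
    binomialSum (suc j) s                                    ≡⟨ sumTo-peel _ j ⟩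
    + 1 * s 0 + sumTo (λ i → + (suc j C suc i) * s (suc i)) j ≡⟨ cong (λ σ → + 1 * s 0 + σ) (trans (sumTo-cong pascal j) (sumTo-+ _ _ j)) ⟩
    + 1 * s 0 + (binomialSum j (s ∘ suc) + Σupper)           ≡⟨ rotate (+ 1 * s 0) (binomialSum j (s ∘ suc)) Σupper ⟩
    (+ 1 * s 0 + Σupper) + binomialSum j (s ∘ suc)           ≡⟨ cong (λ σ → σ + binomialSum j (s ∘ suc)) lower ⟨
    binomialSum j s + binomialSum j (s ∘ suc)                ∎
    where
    open ≡-Reasoning
    g : ℕ → ℤ
    g i = + (j C i) * s i
    Σupper = sumTo (g ∘ suc) j

    pascal : ∀ i → + (suc j C suc i) * s (suc i) ≡ + (j C i) * s (suc i) + g (suc i)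
    pascal i = trans (cong (λ c → + c * s (suc i)) (sym (nCk+nC[k+1]≡[n+1]C[k+1] j i)))
                     (*-distribʳ-+ (s (suc i)) (+ (j C i)) (+ (j C suc i)))

    rotate : ∀ a b c → a + (b + c) ≡ (a + c) + b
    rotate = solve-∀

    lower : binomialSum j s ≡ + 1 * s 0 + Σupper
    lower = begin
      sumTo g j                 ≡⟨ +-identityʳ _ ⟨
      sumTo g j + 0ℤ            ≡⟨ cong (λ t → sumTo g j + t * s (suc j)) (cong +_ (k>n⇒nCk≡0 (ℕₚ.n<1+n j))) ⟨
      sumTo g (suc j)           ≡⟨ sumTo-peel g j ⟩
      + 1 * s 0 + Σupper        ∎

  binomialSum-prime : ∀ {p} → Prime p → ∀ s → binomialSum p s ≡ s 0 + s p [modℤ p ]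
  binomialSum-prime {zero}        p-prime = ⊥-elim (¬prime[0] p-prime)
  binomialSum-prime {suc zero}    p-prime = ⊥-elim (¬prime[1] p-prime)
  binomialSum-prime {p@(suc (suc n))} p-prime s = begin
    binomialSum p s                                                ≡⟨ sumTo-peel _ (suc n) ⟩
    + 1 * s 0 + (sumTo (λ i → + (p C suc i) * s (suc i)) n + + (p C p) * s p)
      ≈⟨ +-cong-modℤ (≡⇒≡[modℤ] (*-identityˡ (s 0))) (+-cong-modℤ middle≡0 (≡⇒≡[modℤ] last-term)) ⟩
    s 0 + (0ℤ + s p)                                               ≡⟨ cong (λ t → s 0 + t) (+-identityˡ (s p)) ⟩
    s 0 + s p                                                      ∎
    where
    open SetoidReasoning (modℤ-setoid p)
    middle≡0 : sumTo (λ i → + (p C suc i) * s (suc i)) n ≡ 0ℤ [modℤ p ]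
    middle≡0 = modℤ-trans
      (sumTo-cong-modℤ n (λ i i≤n → ∣⇒*≡0[modℤ] (s (suc i)) (prime∣C p-prime (ℕ.s≤s ℕ.z≤n) (ℕ.s≤s (ℕ.s≤s i≤n)))))
      (≡⇒≡[modℤ] (sumTo-zero (λ _ → refl) n))
    last-term : + (p C p) * s p ≡ s p
    last-term = trans (cong (λ c → + c * s p) (nCn≡1 p)) (*-identityˡ (s p))

  [1+x]^[j+r]≡binomialSum : ∀ j r k →
    ((one ⊕ X^ 1) ^ᵖ (j ℕ.+ r)) k ≡ binomialSum j (λ i → shift i ((one ⊕ X^ 1) ^ᵖ r) k)
  [1+x]^[j+r]≡binomialSum zero    r k = sym (*-identityˡ _)
  [1+x]^[j+r]≡binomialSum (suc j) r k = begin
    (B ⊗ (B ^ᵖ (j ℕ.+ r))) k                         ≡⟨ one⊕X^-⊗ 1 (B ^ᵖ (j ℕ.+ r)) k ⟩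
    (B ^ᵖ (j ℕ.+ r)) k + shift 1 (B ^ᵖ (j ℕ.+ r)) k  ≡⟨ cong₂ _+_ ([1+x]^[j+r]≡binomialSum j r k) (shifted k) ⟩
    binomialSum j s + binomialSum j (s ∘ suc)         ≡⟨ binomialSum-suc j s ⟨
    binomialSum (suc j) s                             ∎
    where
    open ≡-Reasoning
    B = one ⊕ X^ 1
    s = λ i → shift i (B ^ᵖ r) k

    shifted : ∀ k → shift 1 (B ^ᵖ (j ℕ.+ r)) k ≡ binomialSum j (λ i → shift (suc i) (B ^ᵖ r) k)
    shifted zero    = sym (sumTo-zero (λ i → *-zeroʳ (+ (j C i))) j)
    shifted (suc k) = [1+x]^[j+r]≡binomialSum j r k

  [1+x^p]^m≡[1+x]^[m*p] : ∀ {p} → Prime p → ∀ m → (one ⊕ X^ p) ^ᵖ m ≋ (one ⊕ X^ 1) ^ᵖ (m ℕ.* p) [mod p ]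
  [1+x^p]^m≡[1+x]^[m*p] p-prime zero    k = ≡⇒≡[modℤ] refl
  [1+x^p]^m≡[1+x]^[m*p] {p} p-prime (suc m) k = begin
    (A ⊗ (A ^ᵖ m)) k                      ≡⟨ one⊕X^-⊗ p (A ^ᵖ m) k ⟩
    (A ^ᵖ m) k + shift p (A ^ᵖ m) k        ≈⟨ +-cong-modℤ (IH k) (shift-cong-modℤ p IH k) ⟩
    R k + shift p R k                      ≈⟨ binomialSum-prime p-prime (λ i → shift i R k) ⟨
    binomialSum p (λ i → shift i R k)      ≡⟨ [1+x]^[j+r]≡binomialSum p (m ℕ.* p) k ⟨
    ((one ⊕ X^ 1) ^ᵖ (p ℕ.+ m ℕ.* p)) k    ∎
    where
    open SetoidReasoning (modℤ-setoid p)
    A = one ⊕ X^ p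
    R = (one ⊕ X^ 1) ^ᵖ (m ℕ.* p)
    IH = [1+x^p]^m≡[1+x]^[m*p] p-prime m

open import Data.Nat using (ℕ; suc; _≤_; _∸_; _*_)
open import Data.Nat.Primality using (Prime)
open import Data.Product using (_×_; _,_)
open import Data.Integer.Divisibility.Signed using (∣⇒∣ᵤ)
open IntegerCongruence using (_≋_[mod_]; divides-difference; modℤ-trans)
open VanishingDerivative using (W≡[1+x^[d∸1]]^m)
open Frobenius using ([1+x^p]^m≡[1+x]^[m*p])

W[p+1]≡[1+x]^[p*m] : ∀ {p} → Prime p → ∀ m → W (suc p) m ≋ (one ⊕ X^ 1) ^ᵖ (p * m) [mod p ]
W[p+1]≡[1+x]^[p*m] {p} p-prime m k rewrite ℕₚ.*-comm p m =
  modℤ-trans (W≡[1+x^[d∸1]]^m (suc p) m k) ([1+x^p]^m≡[1+x]^[m*p] p-prime m k)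

≋⇒≡[modᵖ] : ∀ {P Q n} → P ≋ Q [mod n ] → P ≡ Q [modᵖ n ]
≋⇒≡[modᵖ] P≋Q k = ∣⇒∣ᵤ (divides-difference (P≋Q k))

mainTheorem7 : ((d : ℕ) → 2 ≤ d → (m : ℕ) → W d m ≡ (one ⊕ X^ (d ∸ 1)) ^ᵖ m [modᵖ (d ∸ 1) ])
    × ((p : ℕ) → Prime p → (m : ℕ) → W (suc p) m ≡ (one ⊕ X^ 1) ^ᵖ (p * m) [modᵖ p ])
mainTheorem7 = (λ d _ m → ≋⇒≡[modᵖ] (W≡[1+x^[d∸1]]^m d m))
             , (λ p p-prime m → ≋⇒≡[modᵖ] (W[p+1]≡[1+x]^[p*m] p-prime m))
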